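{- Let $k\ge 2$ be an integer. If $G$ is a $\delta$-regular finite simple graph of order $n\ge 2$ with complement $\overline{G}$, then $$d_R^k(G)+d_R^k(\overline{G})\le n+4k-4.$$
   Context: Let $k\ge1$ be an integer. A Roman $k$-dominating function (RkDF) on a graph $G$ is a map $f:V(G)\to\{0,1,2\}$ such that every vertex $v$ with $f(v)=0$ has at least $k$ neighbors $u$ with $f(u)=2$. A set $\{f_1,\ldots,f_d\}$ of pairwise distinct RkDFs on $G$ with $\sum_{i=1}^d f_i(v)\le 2k$ for every $v\in V(G)$ is a Roman $(k,k)$-dominating family on $G$; the maximum number of functions in such a family is the Roman $(k,k)$-domatic number $d_R^k(G)$. -}

module Defs where

open import Data.Nat using (ℕ; zero; suc; _+_; _*_; _≤_; _≡ᵇ_)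
open import Data.Bool using (Bool; true; false; not; _∧_; if_then_else_)
open import Data.Fin using (Fin; _≟_)
open import Data.List using (List; map; allFin)
open import Data.Nat.ListAction using (sum)
open import Data.Product using (Σ; ∃; _×_)
open import Relation.Nullary using (¬_; does)
open import Relation.Binary.PropositionalEquality using (_≡_)

record Graph (n : ℕ) : Set where
  field
    adj   : Fin n → Fin n → Bool
    sym   : ∀ u v → adj u v ≡ adj v u
    irrefl : ∀ v → adj v v ≡ false
open Graph public

complement : ∀ {n} → Graph n → Graph n
complement {n} G = record { adj = a ; sym = s ; irrefl = i }
  where
  a : Fin n → Fin n → Bool
  a u v = not (does (u ≟ v)) ∧ not (adj G u v)
  s : ∀ u v → a u v ≡ a v u
  s u v with u ≟ v | v ≟ u
  ... | Relation.Nullary.yes _ | Relation.Nullary.yes _ = Relation.Binary.PropositionalEquality.refl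
  ... | Relation.Nullary.yes p | Relation.Nullary.no q = Data.Empty.⊥-elim (q (Relation.Binary.PropositionalEquality.sym p))
    where import Data.Empty
  ... | Relation.Nullary.no q | Relation.Nullary.yes p = Data.Empty.⊥-elim (q (Relation.Binary.PropositionalEquality.sym p))
    where import Data.Empty
  ... | Relation.Nullary.no _ | Relation.Nullary.no _ =
    Relation.Binary.PropositionalEquality.cong not (sym G u v)
  i : ∀ v → a v v ≡ false
  i v with v ≟ v
  ... | Relation.Nullary.yes _ = Relation.Binary.PropositionalEquality.refl
  ... | Relation.Nullary.no ¬p = Data.Empty.⊥-elim (¬p Relation.Binary.PropositionalEquality.refl)
    where import Data.Empty

countV : ∀ {n} → (Fin n → Bool) → ℕ
countV {n} P = sum (map (λ u → if P u then 1 else 0) (allFin n))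

degree : ∀ {n} → Graph n → Fin n → ℕ
degree G v = countV (adj G v)

Regular : ∀ {n} → Graph n → ℕ → Set
Regular G δ = ∀ v → degree G v ≡ δ

IsRkDF : ∀ {n} → Graph n → ℕ → (Fin n → ℕ) → Set
IsRkDF G k f =
  (∀ v → f v ≤ 2) ×
  (∀ v → f v ≡ 0 → k ≤ countV (λ u → adj G v u ∧ (f u ≡ᵇ 2)))

IsRkkFamily : ∀ {n} → Graph n → ℕ → (d : ℕ) → (Fin d → Fin n → ℕ) → Set
IsRkkFamily {n} G k d F =
  (∀ i → IsRkDF G k (F i)) ×
  (∀ i j → ¬ (i ≡ j) → ∃ λ v → ¬ (F i v ≡ F j v)) ×
  (∀ v → sum (map (λ i → F i v) (allFin d)) ≤ 2 * k)

IsRkkDomaticNumber : ∀ {n} → Graph n → ℕ → ℕ → Set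
IsRkkDomaticNumber G k d =
  (Σ (Fin d → _) λ F → IsRkkFamily G k d F) ×
  (∀ d′ (F : Fin d′ → _) → IsRkkFamily G k d′ F → d′ ≤ d)

module Submission where

-- Let f be a Roman k-dominating function on a δ-regular graph with n vertices,
-- having Z(f) zeros, T(f) twos and weight w(f).  Double counting the edges
-- between zeros and twos gives k·Z ≤ δ·T, and n + T = Z + w since f only takes
-- the values 0, 1, 2.  Hence  k·n + k·T ≤ δ·T + k·w.
--
-- Summing over a (k,k)-family F₁,…,F_d, with Y = Σ T(Fᵢ) and Σ w(Fᵢ) ≤ 2k·n:
--   d·(kn) + k·Y ≤ δ·Y + 2k·(kn),   and   2Y ≤ Σ w(Fᵢ) ≤ 2kn,  so Y ≤ kn.
-- If Y = 0 every Fᵢ is constantly 1, so distinctness forces d ≤ 1.  Otherwise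
-- Y < k·Y, and for any e with δ ≤ e + 1 this yields d < e + 2k.  Thus
--   d_R^k(G) ≤ max(δ, 1) + 2k − 2   for every δ-regular G (k ≥ 2).
--
-- The complement of a δ-regular graph of order n is (n − 1 − δ)-regular; splitting
-- δ + δ̄ = n − 1 ≥ 1 as δ ≤ e₁ + 1, δ̄ ≤ e₂ + 1 with e₁ + e₂ ≤ n − 2 and adding the
-- two bounds gives d_R^k(G) + d_R^k(Ḡ) ≤ n + 4k − 4.

open import Defs hiding (sym)
open import Data.Nat using (ℕ; _+_; _*_; _∸_; _≤_)
open import Data.Nat using (zero; suc; z≤n; s≤s; _<_; _≡ᵇ_)
open import Data.Nat.Properties hiding (_≟_)
open import Data.Nat.ListAction using () renaming (sum to listSum)
open import Data.Nat.Tactic.RingSolver using (solve-∀)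
open import Data.Bool using (Bool; true; false; _∧_; if_then_else_)
open import Data.Fin using (Fin; zero; suc; _≟_)
open import Data.List using (map; allFin; tabulate)
open import Data.List.Properties using (map-tabulate)
open import Data.Product using (Σ; ∃; _×_; _,_; proj₁; proj₂)
open import Data.Empty using (⊥-elim)
open import Relation.Nullary using (¬_; does; yes; no)
open import Relation.Binary.PropositionalEquality
open import Function using (_∘_; id)
open import Algebra.Properties.Semiring.Sum +-*-semiring
  using (sum; sum-syntax; ∑-distrib-+; ∑-comm; *-distribˡ-sum; sum-cong-≗)

sum-mono-≤ : ∀ {m} {f g : Fin m → ℕ} → (∀ i → f i ≤ g i) → sum f ≤ sum g
sum-mono-≤ {zero}  f≤g = z≤n
sum-mono-≤ {suc m} f≤g = +-mono-≤ (f≤g zero) (sum-mono-≤ (f≤g ∘ suc))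

sum-const : ∀ m c → ∑[ i < m ] c ≡ m * c
sum-const zero    c = refl
sum-const (suc m) c = cong (c +_) (sum-const m c)

sum≡0⇒0 : ∀ {m} (f : Fin m → ℕ) → sum f ≡ 0 → ∀ i → f i ≡ 0
sum≡0⇒0 f total zero    = m+n≡0⇒m≡0 (f zero) total
sum≡0⇒0 f total (suc i) = sum≡0⇒0 (f ∘ suc) (m+n≡0⇒n≡0 (f zero) total) i

listSum-tabulate : ∀ {m} (f : Fin m → ℕ) → listSum (tabulate f) ≡ sum f
listSum-tabulate {zero}  f = refl
listSum-tabulate {suc m} f = cong (f zero +_) (listSum-tabulate (f ∘ suc))

listSum-allFin : ∀ {m} (f : Fin m → ℕ) → listSum (map f (allFin m)) ≡ sum f
listSum-allFin f = trans (cong listSum (map-tabulate id f)) (listSum-tabulate f)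

𝟙 : Bool → ℕ
𝟙 b = if b then 1 else 0

countV-as-sum : ∀ {m} (P : Fin m → Bool) → countV P ≡ ∑[ u < m ] 𝟙 (P u)
countV-as-sum P = listSum-allFin (λ u → 𝟙 (P u))

𝟙-∧ : ∀ a b → 𝟙 (a ∧ b) ≡ 𝟙 a * 𝟙 b
𝟙-∧ true  b = sym (+-identityʳ (𝟙 b))
𝟙-∧ false b = refl

𝟙-∧-≤ʳ : ∀ a b → 𝟙 (a ∧ b) ≤ 𝟙 b
𝟙-∧-≤ʳ true  b = ≤-refl
𝟙-∧-≤ʳ false b = z≤n

sum-𝟙-≟ : ∀ {m} (v : Fin m) → ∑[ u < m ] 𝟙 (does (v ≟ u)) ≡ 1
sum-𝟙-≟ {suc m} zero    = cong suc (trans (sum-const m 0) (*-zeroʳ m))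
sum-𝟙-≟ {suc m} (suc v) = trans (sum-cong-≗ shift) (sum-𝟙-≟ v)
  where
  shift : ∀ u → 𝟙 (does (suc v ≟ suc u)) ≡ 𝟙 (does (v ≟ u))
  shift u with v ≟ u
  ... | yes _ = refl
  ... | no  _ = refl

zeros twos weight : ∀ {n} → (Fin n → ℕ) → ℕ
zeros  {n} f = ∑[ u < n ] 𝟙 (f u ≡ᵇ 0)
twos   {n} f = ∑[ u < n ] 𝟙 (f u ≡ᵇ 2)
weight     f = sum f

value-balance : ∀ x → x ≤ 2 → 1 + 𝟙 (x ≡ᵇ 2) ≡ 𝟙 (x ≡ᵇ 0) + x
value-balance 0 _ = refl
value-balance 1 _ = refl
value-balance 2 _ = refl
value-balance (suc (suc (suc _))) (s≤s (s≤s ()))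

two-indicator≤ : ∀ x → 2 * 𝟙 (x ≡ᵇ 2) ≤ x
two-indicator≤ 0 = z≤n
two-indicator≤ 1 = z≤n
two-indicator≤ 2 = ≤-refl
two-indicator≤ (suc (suc (suc _))) = z≤n

vertices+twos : ∀ {n} (f : Fin n → ℕ) → (∀ v → f v ≤ 2) → n + twos f ≡ zeros f + weight f
vertices+twos {n} f bounded = begin
  n + twos f                                  ≡⟨ cong (_+ twos f) (sym (trans (sum-const n 1) (*-identityʳ n))) ⟩
  ∑[ v < n ] 1 + twos f                       ≡⟨ sym (∑-distrib-+ (λ _ → 1) (λ v → 𝟙 (f v ≡ᵇ 2))) ⟩
  ∑[ v < n ] (1 + 𝟙 (f v ≡ᵇ 2))               ≡⟨ sum-cong-≗ (λ v → value-balance (f v) (bounded v)) ⟩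
  ∑[ v < n ] (𝟙 (f v ≡ᵇ 0) + f v)             ≡⟨ ∑-distrib-+ (λ v → 𝟙 (f v ≡ᵇ 0)) f ⟩
  zeros f + weight f                          ∎
  where open ≡-Reasoning

2twos≤weight : ∀ {n} (f : Fin n → ℕ) → 2 * twos f ≤ weight f
2twos≤weight f = ≤-trans (≤-reflexive (*-distribˡ-sum 2 (λ v → 𝟙 (f v ≡ᵇ 2))))
                         (sum-mono-≤ (λ v → two-indicator≤ (f v)))

-- Roman k-dominating functions on a graph

module _ {n : ℕ} (G : Graph n) where

  twoNeighbours : (Fin n → ℕ) → Fin n → ℕ
  twoNeighbours f v = countV (λ u → adj G v u ∧ (f u ≡ᵇ 2))

  twoNeighbours-as-sum : ∀ f v →
    twoNeighbours f v ≡ ∑[ u < n ] (𝟙 (adj G v u) * 𝟙 (f u ≡ᵇ 2))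
  twoNeighbours-as-sum f v =
    trans (countV-as-sum (λ u → adj G v u ∧ (f u ≡ᵇ 2))) (sum-cong-≗ (λ u → 𝟙-∧ (adj G v u) (f u ≡ᵇ 2)))

  twoNeighbours≤twos : ∀ f v → twoNeighbours f v ≤ twos f
  twoNeighbours≤twos f v = ≤-trans (≤-reflexive (countV-as-sum (λ u → adj G v u ∧ (f u ≡ᵇ 2))))
                                   (sum-mono-≤ (λ u → 𝟙-∧-≤ʳ (adj G v u) (f u ≡ᵇ 2)))

  -- With k ≥ 1, an RkDF without twos has no zeros either, so it is constantly 1.
  no-twos⇒one : ∀ {k f} → 1 ≤ k → IsRkDF G k f → twos f ≡ 0 → ∀ v → f v ≡ 1
  no-twos⇒one {k} {f} k≥1 (bounded , dominated) none v with f v in fv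
  ... | 0 = ⊥-elim (<⇒≱ k≥1 (subst (k ≤_) none
                     (≤-trans (dominated v fv) (twoNeighbours≤twos f v))))
  ... | 1 = refl
  ... | 2 = ⊥-elim (0≢1+n (sym (subst (λ x → 𝟙 (x ≡ᵇ 2) ≡ 0) fv (sum≡0⇒0 _ none v))))
  ... | suc (suc (suc _)) = ⊥-elim (<⇒≱ (s≤s (s≤s (s≤s z≤n))) (subst (_≤ 2) fv (bounded v)))

  module _ {δ : ℕ} (regular : Regular G δ) where

    column-degree : ∀ u → ∑[ v < n ] 𝟙 (adj G v u) ≡ δ
    column-degree u = begin
      ∑[ v < n ] 𝟙 (adj G v u)   ≡⟨ sum-cong-≗ (λ v → cong 𝟙 (Graph.sym G v u)) ⟩
      ∑[ v < n ] 𝟙 (adj G u v)   ≡⟨ sym (countV-as-sum (adj G u)) ⟩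
      degree G u                 ≡⟨ regular u ⟩
      δ                          ∎
      where open ≡-Reasoning

    -- Double counting zero–two edges:  k·Z(f) ≤ δ·T(f).
    zeros-bound : ∀ {k} f → (∀ v → f v ≡ 0 → k ≤ twoNeighbours f v) → k * zeros f ≤ δ * twos f
    zeros-bound {k} f dominated = begin
      k * zeros f                                              ≡⟨ *-distribˡ-sum k (λ v → 𝟙 (f v ≡ᵇ 0)) ⟩
      ∑[ v < n ] (k * 𝟙 (f v ≡ᵇ 0))                            ≤⟨ sum-mono-≤ zero-vertex ⟩
      ∑[ v < n ] ∑[ u < n ] (𝟙 (adj G v u) * 𝟙 (f u ≡ᵇ 2))     ≡⟨ ∑-comm (λ v u → 𝟙 (adj G v u) * 𝟙 (f u ≡ᵇ 2)) ⟩
      ∑[ u < n ] ∑[ v < n ] (𝟙 (adj G v u) * 𝟙 (f u ≡ᵇ 2))     ≡⟨ sum-cong-≗ two-vertex ⟩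
      ∑[ u < n ] (δ * 𝟙 (f u ≡ᵇ 2))                            ≡⟨ sym (*-distribˡ-sum δ (λ u → 𝟙 (f u ≡ᵇ 2))) ⟩
      δ * twos f                                               ∎
      where
      open ≤-Reasoning
      zero-vertex : ∀ v → k * 𝟙 (f v ≡ᵇ 0) ≤ ∑[ u < n ] (𝟙 (adj G v u) * 𝟙 (f u ≡ᵇ 2))
      zero-vertex v with f v in fv
      ... | zero  = ≤-trans (≤-reflexive (*-identityʳ k))
                      (≤-trans (dominated v fv) (≤-reflexive (twoNeighbours-as-sum f v)))
      ... | suc _ = ≤-trans (≤-reflexive (*-zeroʳ k)) z≤n
      -- a two is counted once by each of its δ neighbours
      two-vertex : ∀ u → ∑[ v < n ] (𝟙 (adj G v u) * 𝟙 (f u ≡ᵇ 2)) ≡ δ * 𝟙 (f u ≡ᵇ 2)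
      two-vertex u = trans (sum-cong-≗ (λ v → *-comm (𝟙 (adj G v u)) (𝟙 (f u ≡ᵇ 2))))
                     (trans (sym (*-distribˡ-sum (𝟙 (f u ≡ᵇ 2)) (λ v → 𝟙 (adj G v u))))
                     (trans (cong (𝟙 (f u ≡ᵇ 2) *_) (column-degree u)) (*-comm _ δ)))

    rkdf-inequality : ∀ {k f} → IsRkDF G k f → k * n + k * twos f ≤ δ * twos f + k * weight f
    rkdf-inequality {k} {f} (bounded , dominated) = begin
      k * n + k * twos f             ≡⟨ sym (*-distribˡ-+ k n (twos f)) ⟩
      k * (n + twos f)               ≡⟨ cong (k *_) (vertices+twos f bounded) ⟩
      k * (zeros f + weight f)       ≡⟨ *-distribˡ-+ k (zeros f) (weight f) ⟩
      k * zeros f + k * weight f     ≤⟨ +-monoˡ-≤ (k * weight f) (zeros-bound f dominated) ⟩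
      δ * twos f + k * weight f      ∎
      where open ≤-Reasoning

-- Roman (k,k)-dominating families

distinct-constant : ∀ {n d} (F : Fin d → Fin n → ℕ) (g : Fin n → ℕ) →
  (∀ i j → ¬ (i ≡ j) → ∃ λ v → ¬ (F i v ≡ F j v)) → (∀ i v → F i v ≡ g v) → d ≤ 1
distinct-constant {d = zero}        F g distinct same = z≤n
distinct-constant {d = suc zero}    F g distinct same = s≤s z≤n
distinct-constant {d = suc (suc d)} F g distinct same with distinct zero (suc zero) (λ ())
... | v , differ = ⊥-elim (differ (trans (same zero v) (sym (same (suc zero) v))))

module _ {n : ℕ} (G : Graph n) {k d : ℕ} {F : Fin d → Fin n → ℕ} (family : IsRkkFamily G k d F) where

  private
    rkdf = proj₁ family
    distinct = proj₁ (proj₂ family)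
    capacity = proj₂ (proj₂ family)

  totalTwos : ℕ
  totalTwos = ∑[ i < d ] twos (F i)

  totalWeight : ℕ
  totalWeight = ∑[ i < d ] weight (F i)

  -- Each vertex carries at most 2k in total, so the family weighs at most 2k·n.
  totalWeight≤ : totalWeight ≤ (2 * k) * n
  totalWeight≤ = begin
    ∑[ i < d ] ∑[ v < n ] F i v   ≡⟨ ∑-comm F ⟩
    ∑[ v < n ] ∑[ i < d ] F i v   ≤⟨ sum-mono-≤ (λ v → ≤-trans (≤-reflexive (sym (listSum-allFin (λ i → F i v)))) (capacity v)) ⟩
    ∑[ v < n ] (2 * k)            ≡⟨ sum-const n (2 * k) ⟩
    n * (2 * k)                   ≡⟨ *-comm n (2 * k) ⟩
    (2 * k) * n                   ∎
    where open ≤-Reasoning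

  -- Y ≤ kn, since 2Y ≤ total weight ≤ 2kn.
  totalTwos≤ : totalTwos ≤ k * n
  totalTwos≤ = *-cancelˡ-≤ 2 (begin
    2 * totalTwos                    ≡⟨ *-distribˡ-sum 2 (λ i → twos (F i)) ⟩
    ∑[ i < d ] (2 * twos (F i))      ≤⟨ sum-mono-≤ (λ i → 2twos≤weight (F i)) ⟩
    totalWeight                      ≤⟨ totalWeight≤ ⟩
    (2 * k) * n                      ≡⟨ *-assoc 2 k n ⟩
    2 * (k * n)                      ∎)
    where open ≤-Reasoning

  -- Without any twos every member is constantly 1, so the family is trivial.
  no-twos⇒trivial : 1 ≤ k → totalTwos ≡ 0 → d ≤ 1
  no-twos⇒trivial k≥1 none = distinct-constant F (λ _ → 1) distinct
    (λ i → no-twos⇒one G k≥1 (rkdf i) (sum≡0⇒0 (λ i → twos (F i)) none i))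

  family-inequality : ∀ {δ} → Regular G δ →
    d * (k * n) + k * totalTwos ≤ δ * totalTwos + (2 * k) * (k * n)
  family-inequality {δ} regular = begin
    d * (k * n) + k * totalTwos
      ≡⟨ cong₂ _+_ (sym (sum-const d (k * n))) (*-distribˡ-sum k (λ i → twos (F i))) ⟩
    ∑[ i < d ] (k * n) + ∑[ i < d ] (k * twos (F i))
      ≡⟨ sym (∑-distrib-+ (λ _ → k * n) (λ i → k * twos (F i))) ⟩
    ∑[ i < d ] (k * n + k * twos (F i))
      ≤⟨ sum-mono-≤ (λ i → rkdf-inequality G regular (rkdf i)) ⟩
    ∑[ i < d ] (δ * twos (F i) + k * weight (F i))
      ≡⟨ ∑-distrib-+ (λ i → δ * twos (F i)) (λ i → k * weight (F i)) ⟩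
    ∑[ i < d ] (δ * twos (F i)) + ∑[ i < d ] (k * weight (F i))
      ≡⟨ sym (cong₂ _+_ (*-distribˡ-sum δ (λ i → twos (F i))) (*-distribˡ-sum k (λ i → weight (F i)))) ⟩
    δ * totalTwos + k * totalWeight
      ≤⟨ +-monoʳ-≤ (δ * totalTwos) (*-monoʳ-≤ k totalWeight≤) ⟩
    δ * totalTwos + k * ((2 * k) * n)
      ≡⟨ cong (δ * totalTwos +_) (rearrange k n) ⟩
    δ * totalTwos + (2 * k) * (k * n)
      ∎
    where
    open ≤-Reasoning
    rearrange : ∀ k n → k * ((2 * k) * n) ≡ (2 * k) * (k * n)
    rearrange = solve-∀

-- From the summed inequality: if Y = 0 forces d ≤ 1, Y ≤ M and δ ≤ e + 1,
-- then d < e + 2k.  For Y ≥ 1 the slack k·Y > Y absorbs the one extra unit of δ.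
counting-bound : ∀ {k d e δ M} Y → 2 ≤ k → (Y ≡ 0 → d ≤ 1) → Y ≤ M → δ ≤ suc e →
  d * M + k * Y ≤ δ * Y + (2 * k) * M → d < e + 2 * k
counting-bound {k} {e = e} zero k≥2 trivial _ _ _ =
  ≤-trans (s≤s (trivial refl)) (≤-trans k≥2 (≤-trans (m≤n*m k 2) (m≤n+m (2 * k) e)))
counting-bound {k} {d} {e} {δ} {M} Y@(suc _) k≥2 _ Y≤M δ≤ summed =
  *-cancelʳ-< M d (e + 2 * k) (+-cancelˡ-< Y (d * M) ((e + 2 * k) * M) (begin-strict
    Y + d * M                      ≡⟨ +-comm Y (d * M) ⟩
    d * M + Y                      <⟨ +-monoʳ-< (d * M) Y<kY ⟩
    d * M + k * Y                  ≤⟨ summed ⟩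
    δ * Y + (2 * k) * M            ≤⟨ +-monoˡ-≤ ((2 * k) * M) (*-monoˡ-≤ Y δ≤) ⟩
    (Y + e * Y) + (2 * k) * M      ≤⟨ +-monoˡ-≤ ((2 * k) * M) (+-monoʳ-≤ Y (*-monoʳ-≤ e Y≤M)) ⟩
    (Y + e * M) + (2 * k) * M      ≡⟨ +-assoc Y (e * M) ((2 * k) * M) ⟩
    Y + (e * M + (2 * k) * M)      ≡⟨ cong (Y +_) (sym (*-distribʳ-+ M e (2 * k))) ⟩
    Y + (e + 2 * k) * M            ∎))
  where
  open ≤-Reasoning
  Y<kY : Y < k * Y
  Y<kY = subst (_< k * Y) (*-identityˡ Y) (*-monoˡ-< Y k≥2)

-- The size bound d_R^k(G) ≤ max(δ, 1) + 2k − 2 for a δ-regular graph G: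
-- every Roman (k,k)-dominating family has fewer than e + 2k members when δ ≤ e + 1.
family-size-bound : ∀ {n k d δ e} (G : Graph n) {F : Fin d → Fin n → ℕ} → 2 ≤ k →
  Regular G δ → IsRkkFamily G k d F → δ ≤ suc e → d < e + 2 * k
family-size-bound G k≥2 regular family δ≤ =
  counting-bound (totalTwos G family) k≥2
    (no-twos⇒trivial G family (≤-trans (s≤s z≤n) k≥2))
    (totalTwos≤ G family) δ≤ (family-inequality G family regular)

-- Complements of regular graphs

-- Each vertex u is v itself, a neighbour of v in G, or a neighbour in the complement.
degree-partition : ∀ {n} (G : Graph n) v → suc (degree G v + degree (complement G) v) ≡ n
degree-partition {n} G v = begin
  suc (degree G v + degree (complement G) v)
    ≡⟨ cong₂ (λ a b → suc (a + b)) (countV-as-sum (adj G v)) (countV-as-sum (adj (complement G) v)) ⟩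
  suc (∑[ u < n ] 𝟙 (adj G v u) + ∑[ u < n ] 𝟙 (adj (complement G) v u))
    ≡⟨ cong₂ (λ a b → a + b) (sym (sum-𝟙-≟ v)) (sym (∑-distrib-+ (λ u → 𝟙 (adj G v u)) (λ u → 𝟙 (adj (complement G) v u)))) ⟩
  ∑[ u < n ] 𝟙 (does (v ≟ u)) + ∑[ u < n ] (𝟙 (adj G v u) + 𝟙 (adj (complement G) v u))
    ≡⟨ sym (∑-distrib-+ (λ u → 𝟙 (does (v ≟ u))) (λ u → 𝟙 (adj G v u) + 𝟙 (adj (complement G) v u))) ⟩
  ∑[ u < n ] (𝟙 (does (v ≟ u)) + (𝟙 (adj G v u) + 𝟙 (adj (complement G) v u)))
    ≡⟨ sum-cong-≗ exactly-one ⟩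
  ∑[ u < n ] 1
    ≡⟨ trans (sum-const n 1) (*-identityʳ n) ⟩
  n ∎
  where
  open ≡-Reasoning
  exactly-one : ∀ u → 𝟙 (does (v ≟ u)) + (𝟙 (adj G v u) + 𝟙 (adj (complement G) v u)) ≡ 1
  exactly-one u with v ≟ u
  ... | yes refl rewrite irrefl G v = refl
  ... | no _ with adj G v u
  ...   | true  = refl
  ...   | false = refl

complement-regular : ∀ {m δ} (G : Graph (suc m)) → Regular G δ → Regular (complement G) (m ∸ δ)
complement-regular {m} {δ} G regular v = begin
  degree (complement G) v                ≡⟨ sym (m+n∸m≡n δ (degree (complement G) v)) ⟩
  δ + degree (complement G) v ∸ δ        ≡⟨ cong (λ a → a + degree (complement G) v ∸ δ) (sym (regular v)) ⟩
  degree G v + degree (complement G) v ∸ δ ≡⟨ cong (_∸ δ) (suc-injective (degree-partition G v)) ⟩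
  m ∸ δ                                  ∎
  where open ≡-Reasoning

regular-degree-sum : ∀ {m δ} (G : Graph (suc m)) → Regular G δ → δ + (m ∸ δ) ≡ m
regular-degree-sum {m} {δ} G regular = begin
  δ + (m ∸ δ)                                 ≡⟨ cong₂ _+_ (sym (regular zero)) (sym (complement-regular G regular zero)) ⟩
  degree G zero + degree (complement G) zero  ≡⟨ suc-injective (degree-partition G zero) ⟩
  m                                           ∎
  where open ≡-Reasoning

split-positive : ∀ a b c → a + b ≡ suc c →
  Σ ℕ λ e₁ → Σ ℕ λ e₂ → a ≤ suc e₁ × b ≤ suc e₂ × e₁ + e₂ ≤ c
split-positive zero    b       c eq = 0 , c , z≤n , ≤-reflexive eq , ≤-refl
split-positive (suc a) zero    c eq = c , 0 , ≤-reflexive (trans (sym (+-identityʳ (suc a))) eq) , z≤n , ≤-reflexive (+-identityʳ c)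
split-positive (suc a) (suc b) c eq =
  a , b , ≤-refl , ≤-refl , ≤-trans (+-monoʳ-≤ a (n≤1+n b)) (≤-reflexive (suc-injective eq))

sum-of-bounds : ∀ {k d₁ d₂ e₁ e₂ c} → d₁ < e₁ + 2 * k → d₂ < e₂ + 2 * k → e₁ + e₂ ≤ c →
  d₁ + d₂ ≤ suc (suc c) + 4 * k ∸ 4
sum-of-bounds {k} {d₁} {d₂} {e₁} {e₂} {c} b₁ b₂ e≤c = m+n≤o⇒m≤o∸n (d₁ + d₂) (begin
  d₁ + d₂ + 4                          ≡⟨ shift d₁ d₂ ⟩
  suc d₁ + suc d₂ + 2                  ≤⟨ +-monoˡ-≤ 2 (+-mono-≤ b₁ b₂) ⟩
  (e₁ + 2 * k) + (e₂ + 2 * k) + 2      ≡⟨ regroup e₁ e₂ k ⟩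
  (e₁ + e₂) + 4 * k + 2                ≤⟨ +-monoˡ-≤ 2 (+-monoˡ-≤ (4 * k) e≤c) ⟩
  c + 4 * k + 2                        ≡⟨ finish c k ⟩
  suc (suc c) + 4 * k                  ∎)
  where
  open ≤-Reasoning
  shift : ∀ a b → a + b + 4 ≡ suc a + suc b + 2
  shift = solve-∀
  regroup : ∀ a b k → (a + 2 * k) + (b + 2 * k) + 2 ≡ (a + b) + 4 * k + 2
  regroup = solve-∀
  finish : ∀ c k → c + 4 * k + 2 ≡ suc (suc c) + 4 * k
  finish = solve-∀

corollary6 : (k : ℕ) → 2 ≤ k → (n : ℕ) → 2 ≤ n → (G : Graph n) → (δ : ℕ) → Regular G δ →
    (d₁ d₂ : ℕ) → IsRkkDomaticNumber G k d₁ → IsRkkDomaticNumber (complement G) k d₂ →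
    d₁ + d₂ ≤ n + 4 * k ∸ 4
corollary6 k k≥2 (suc zero) (s≤s ()) G δ regular d₁ d₂ _ _
corollary6 k k≥2 (suc (suc c)) _ G δ regular d₁ d₂ ((F₁ , family₁) , _) ((F₂ , family₂) , _)
  with split-positive δ (suc c ∸ δ) c (regular-degree-sum G regular)
... | e₁ , e₂ , δ≤ , δ̄≤ , e≤c =
  sum-of-bounds {k} {e₁ = e₁} {e₂} (family-size-bound G k≥2 regular family₁ δ≤)
                (family-size-bound (complement G) k≥2 (complement-regular G regular) family₂ δ̄≤)
                e≤c
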